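{- For $n=2$, there is a polytope with a pair of vertices $v^{(1)},v^{(2)}$ for which every optimal feasible maximal circuit walk from $v^{(1)}$ to $v^{(2)}$ is backwards. Hence for this pair, $\mathcal{CD}_{fmb}\neq\mathcal{CD}_{fm}$.
   Context: Polytopes are $P=\{z\in\mathbb{R}^n: Az=b,\ Bz\leq d\}$ with integer matrices $A,B$. A circuit is a vector $g\in\ker(A)\setminus\{0\}$ such that $Bg$ has inclusion-minimal support in $\{Bz: z\in\ker(A)\setminus\{0\}\}$, normalized to coprime integer components. A circuit walk of length $k$ from vertex $v^{(1)}$ to vertex $v^{(2)}$ is $v^{(1)}=y^{(0)},\dots,y^{(k)}=v^{(2)}$ with $y^{(i+1)}-y^{(i)}=\alpha_ig^i$, $g^i$ circuits, $\alpha_i>0$. It is feasible if all $y^{(i)}\in P$; maximal if $y^{(i)}+\alpha g^i\notin P$ for all $\alpha>\alpha_i$ and all $i$; backwards if $g^j=-g^i$ for some $i,j$ (non-backwards otherwise). $\mathcal{CD}_{fm}$ is the minimum length of a feasible maximal circuit walk (such walks of that length are optimal), $\mathcal{CD}_{fmb}$ the minimum length of a feasible maximal non-backwards one.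
   Formalization: Points of the polytope have rational coordinates instead of real ones and the step lengths $\alpha_i$ are rational, so vertices, maximality and the minima $\mathcal{CD}_{fm}$ and $\mathcal{CD}_{fmb}$ range over rational walks only. -}

module Defs where

open import Data.Nat as ℕ using (ℕ; zero; suc)
open import Data.Nat.Divisibility using (_∣_)
open import Data.Integer as ℤ using (ℤ)
open import Data.Rational using (ℚ; 0ℚ; _+_; _*_; _≤_; _<_; -_; ∣_∣; _/_)
open import Data.Fin using (Fin; zero; suc; fromℕ; inject₁)
open import Data.Product using (Σ; _×_; ∃)
open import Relation.Nullary using (¬_)
open import Relation.Binary.PropositionalEquality using (_≡_)

-- Points of ℚ^n (rational coordinates suffice, all walks
-- from a vertex of a rational polytope stay rational).
Point : ℕ → Set
Point n = Fin n → ℚ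

IntVec : ℕ → Set
IntVec n = Fin n → ℤ

ι : ℤ → ℚ
ι z = z / 1

sumℚ : ∀ {n} → (Fin n → ℚ) → ℚ
sumℚ {zero}  f = 0ℚ
sumℚ {suc n} f = f zero + sumℚ (λ i → f (suc i))

_·_ : ∀ {m n} → (Fin m → Fin n → ℤ) → Point n → Point m
(M · z) i = sumℚ (λ j → ι (M i j) * z j)

toℚ : ∀ {n} → IntVec n → Point n
toℚ g i = ι (g i)

record Polyhedron (n : ℕ) : Set where
  field
    m₁ m₂ : ℕ
    A : Fin m₁ → Fin n → ℤ
    b : Fin m₁ → ℚ
    B : Fin m₂ → Fin n → ℤ
    d : Fin m₂ → ℚ

module _ {n : ℕ} (P : Polyhedron n) where
  open Polyhedron P

  _∈P : Point n → Set
  z ∈P = (∀ i → (A · z) i ≡ b i) × (∀ j → (B · z) j ≤ d j)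

  IsPolytope : Set
  IsPolytope = Σ ℚ λ R → ∀ z → z ∈P → ∀ t → ∣ z t ∣ ≤ R

  IsVertex : Point n → Set
  IsVertex v = v ∈P × (∀ x y (λ' : ℚ) → x ∈P → y ∈P → 0ℚ < λ' → λ' < 1ℚ' →
                 (∀ t → v t ≡ λ' * x t + (1ℚ' + - λ') * y t) → ∀ t → x t ≡ y t)
    where 1ℚ' = ℤ.+ 1 / 1

  InKer : Point n → Set
  InKer z = ∀ i → (A · z) i ≡ 0ℚ

  NonZeroVec : Point n → Set
  NonZeroVec z = ¬ (∀ t → z t ≡ 0ℚ)

  SuppSub : Point n → Point n → Set
  SuppSub z w = ∀ j → ¬ ((B · z) j ≡ 0ℚ) → ¬ ((B · w) j ≡ 0ℚ)

  Coprime : IntVec n → Set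
  Coprime g = ∀ (k : ℕ) → (∀ t → k ∣ ℤ.∣ g t ∣) → k ≡ 1

  IsCircuit : IntVec n → Set
  IsCircuit g = InKer (toℚ g) × NonZeroVec (toℚ g) × Coprime g ×
    (∀ z → InKer z → NonZeroVec z → SuppSub z (toℚ g) → SuppSub (toℚ g) z)

  record CircuitWalk (v w : Point n) (k : ℕ) : Set where
    field
      y : Fin (suc k) → Point n
      g : Fin k → IntVec n
      α : Fin k → ℚ
      start : ∀ t → y zero t ≡ v t
      end : ∀ t → y (fromℕ k) t ≡ w t
      step : ∀ i t → y (suc i) t ≡ y (inject₁ i) t + α i * ι (g i t)
      pos : ∀ i → 0ℚ < α i
      circ : ∀ i → IsCircuit (g i)

  module _ {v w : Point n} {k : ℕ} (W : CircuitWalk v w k) where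
    open CircuitWalk W

    Feasible : Set
    Feasible = ∀ i → y i ∈P

    Maximal : Set
    Maximal = ∀ i (α' : ℚ) → α i < α' →
      ¬ ((λ t → y (inject₁ i) t + α' * ι (g i t)) ∈P)

    FeasibleMaximal : Set
    FeasibleMaximal = Feasible × Maximal

    Backwards : Set
    Backwards = Σ (Fin k) λ i → Σ (Fin k) λ j → ∀ t → g j t ≡ ℤ.- g i t

  IsCDfm : Point n → Point n → ℕ → Set
  IsCDfm v w k =
    Σ (CircuitWalk v w k) FeasibleMaximal ×
    (∀ j (W : CircuitWalk v w j) → FeasibleMaximal W → k ℕ.≤ j)

  IsCDfmb : Point n → Point n → ℕ → Set
  IsCDfmb v w k =
    Σ (CircuitWalk v w k) (λ W → FeasibleMaximal W × ¬ Backwards W) ×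
    (∀ j (W : CircuitWalk v w j) → FeasibleMaximal W → ¬ Backwards W → k ℕ.≤ j)

{-# OPTIONS --safe #-}
module Submission where

-- In the plane, the circuits of a polygon whose rows are primitive integer vectors are the rows
-- rotated by ±90°, i.e. its edge directions. A maximal step along a circuit is pinned down by the
-- row that blocks it, so the feasible maximal walks of bounded length from a vertex form a finite
-- tree whose nodes can be computed exactly over ℚ. For the polygon rows · z ≤ bounds, this tree
-- shows that no walk of length at most 2 leads from v₁ = (−28, −4) to v₂ = (0, 0), and that every
-- walk of length 3 between them moves along both (0, 1) and (0, −1), as v₁ → (−28, 7) → (0, 1) → v₂
-- does.

open import Defs
open import Algebra.Bundles using (AbelianGroup)
import Algebra.Properties.Group as GroupProperties
open import Data.Empty using (⊥; ⊥-elim)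
open import Data.Fin using (Fin; zero; suc; inject₁; #_)
open import Data.Fin.Properties using (all?; any?)
open import Data.Integer as ℤ using (ℤ; +_; -[1+_])
import Data.Integer.Properties as ℤP
import Data.Integer.Solver as ℤSolver
open import Data.Maybe as Maybe using (Maybe; just; nothing; _<∣>_)
open import Data.Nat as ℕ using (ℕ; zero; suc)
import Data.Nat.Coprimality as C
open import Data.Nat.Divisibility using (_∣_; ∣-antisym; m∣m*n; n∣m*n)
import Data.Nat.Properties as ℕP
open import Data.Product using (Σ; _×_; _,_; proj₁; proj₂)
open import Data.Product.Properties using (≡-dec)
open import Data.Rational as ℚ using (ℚ; 0ℚ; 1ℚ; _+_; _*_; _-_; -_; _≤_; _<_; ↥_)
open import Data.Rational.Literals using (fromℤ)
import Data.Rational.Properties as ℚP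
open import Data.Rational.Solver using (module +-*-Solver)
open import Data.Sign as Sign using (Sign)
open import Data.Sum using (_⊎_; inj₁; inj₂; [_,_]′)
open import Data.Vec as Vec using (Vec; []; _∷_; lookup)
import Data.Vec.Functional as Vector
open import Function using (_∘_)
open import Relation.Binary using (tri<; tri≈; tri>)
open import Relation.Binary.PropositionalEquality
  using (_≡_; _≗_; refl; sym; trans; cong; cong₂; subst; subst₂; module ≡-Reasoning)
open import Relation.Nullary
  using (¬_; Dec; yes; no; map′; ¬?; _×-dec_; _→-dec_; dec⇒maybe; decidable-stable; from-yes)
open import Relation.Nullary.Decidable using (True; toWitness)

open GroupProperties ℚP.+-0-group using (x∙y⁻¹≈ε⇒x≈y)

ι≡fromℤ : ∀ z → ι z ≡ fromℤ z
ι≡fromℤ (+ n)    = ℚP.normalize-coprime (C.sym (C.1-coprimeTo n))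
ι≡fromℤ -[1+ n ] = cong -_ (ℚP.normalize-coprime (C.sym (C.1-coprimeTo (suc n))))

ι-injective : ∀ {x y} → ι x ≡ ι y → x ≡ y
ι-injective {x} {y} eq = cong ↥_ (trans (sym (ι≡fromℤ x)) (trans eq (ι≡fromℤ y)))

ι-+ : ∀ x y → ι (x ℤ.+ y) ≡ ι x + ι y
ι-+ x y = begin
  ι (x ℤ.+ y)                      ≡⟨ cong₂ (λ a b → ι (a ℤ.+ b)) (sym (ℤP.*-identityʳ x)) (sym (ℤP.*-identityʳ y)) ⟩
  ι (x ℤ.* + 1 ℤ.+ y ℤ.* + 1)      ≡⟨⟩
  fromℤ x + fromℤ y                ≡⟨ cong₂ _+_ (sym (ι≡fromℤ x)) (sym (ι≡fromℤ y)) ⟩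
  ι x + ι y                        ∎
  where open ≡-Reasoning

ι-* : ∀ x y → ι (x ℤ.* y) ≡ ι x * ι y
ι-* x y = begin
  ι (x ℤ.* y)           ≡⟨⟩
  fromℤ x * fromℤ y     ≡⟨ cong₂ _*_ (sym (ι≡fromℤ x)) (sym (ι≡fromℤ y)) ⟩
  ι x * ι y             ∎
  where open ≡-Reasoning

ι-neg : ∀ x → ι (ℤ.- x) ≡ - ι x
ι-neg x = begin
  ι (ℤ.- x)        ≡⟨ ι≡fromℤ (ℤ.- x) ⟩
  fromℤ (ℤ.- x)    ≡⟨ fromℤ-neg x ⟩
  - fromℤ x        ≡⟨ cong -_ (sym (ι≡fromℤ x)) ⟩
  - ι x            ∎
  where
  open ≡-Reasoning
  fromℤ-neg : ∀ x → fromℤ (ℤ.- x) ≡ - fromℤ x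
  fromℤ-neg (+ zero)  = refl
  fromℤ-neg ℤ.+[1+ n ] = refl
  fromℤ-neg -[1+ n ]  = refl

sumℚ-cong : ∀ {n} {f h : Fin n → ℚ} → f ≗ h → sumℚ f ≡ sumℚ h
sumℚ-cong {zero}  _  = refl
sumℚ-cong {suc n} eq = cong₂ _+_ (eq zero) (sumℚ-cong (eq ∘ suc))

sumℚ-+ : ∀ {n} (f h : Fin n → ℚ) → sumℚ (λ i → f i + h i) ≡ sumℚ f + sumℚ h
sumℚ-+ {zero}  f h = refl
sumℚ-+ {suc n} f h = trans (cong (_+_ (f zero + h zero)) (sumℚ-+ (f ∘ suc) (h ∘ suc)))
                           (interchange (f zero) (h zero) (sumℚ (f ∘ suc)) (sumℚ (h ∘ suc)))
  where
  open +-*-Solver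
  interchange : ∀ a b c e → (a + b) + (c + e) ≡ (a + c) + (b + e)
  interchange = solve 4 (λ a b c e → (a :+ b) :+ (c :+ e) := (a :+ c) :+ (b :+ e)) refl

sumℚ-* : ∀ {n} c (f : Fin n → ℚ) → sumℚ (λ i → c * f i) ≡ c * sumℚ f
sumℚ-* {zero}  c f = sym (ℚP.*-zeroʳ c)
sumℚ-* {suc n} c f = trans (cong (_+_ (c * f zero)) (sumℚ-* c (f ∘ suc)))
                           (sym (ℚP.*-distribˡ-+ c (f zero) (sumℚ (f ∘ suc))))

sumℚ-neg : ∀ {n} (f : Fin n → ℚ) → sumℚ (λ i → - f i) ≡ - sumℚ f
sumℚ-neg {zero}  f = refl
sumℚ-neg {suc n} f = trans (cong (_+_ (- f zero)) (sumℚ-neg (f ∘ suc)))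
                           (sym (ℚP.neg-distrib-+ (f zero) (sumℚ (f ∘ suc))))

move : ∀ {n} → Point n → ℚ → IntVec n → Point n
move y α g t = y t + α * ι (g t)

module _ {m n : ℕ} (M : Fin m → Fin n → ℤ) where

  ·-cong : ∀ {y z} → y ≗ z → M · y ≗ M · z
  ·-cong eq i = sumℚ-cong (λ j → cong (ι (M i j) *_) (eq j))

  ·-+ : ∀ y z i → (M · (λ t → y t + z t)) i ≡ (M · y) i + (M · z) i
  ·-+ y z i = trans (sumℚ-cong (λ j → ℚP.*-distribˡ-+ (ι (M i j)) (y j) (z j)))
                    (sumℚ-+ (λ j → ι (M i j) * y j) (λ j → ι (M i j) * z j))

  ·-* : ∀ c y i → (M · (λ t → c * y t)) i ≡ c * (M · y) i
  ·-* c y i = trans (sumℚ-cong (λ j → swap (ι (M i j)) c (y j)))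
                    (sumℚ-* c (λ j → ι (M i j) * y j))
    where
    open +-*-Solver
    swap : ∀ a b e → a * (b * e) ≡ b * (a * e)
    swap = solve 3 (λ a b e → a :* (b :* e) := b :* (a :* e)) refl

  ·-move : ∀ y α g i → (M · move y α g) i ≡ (M · y) i + α * (M · toℚ g) i
  ·-move y α g i = trans (·-+ y (λ t → α * toℚ g t) i) (cong (_+_ ((M · y) i)) (·-* α (toℚ g) i))

  ·-combination : ∀ l x r y i → (M · (λ t → l * x t + r * y t)) i ≡ l * (M · x) i + r * (M · y) i
  ·-combination l x r y i = trans (·-+ _ _ i) (cong₂ _+_ (·-* l x i) (·-* r y i))

  ·-neg : ∀ y i → (M · (λ t → - y t)) i ≡ - (M · y) i
  ·-neg y i = trans (sumℚ-cong (λ j → sym (ℚP.neg-distribʳ-* (ι (M i j)) (y j))))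
                    (sumℚ-neg (λ j → ι (M i j) * y j))

  ·-toℚ-neg : ∀ g i → (M · toℚ (λ t → ℤ.- g t)) i ≡ - (M · toℚ g) i
  ·-toℚ-neg g i = trans (·-cong (ι-neg ∘ g) i) (·-neg (toℚ g) i)

convex-at-bound : ∀ {a b c l r} → a ≤ c → b ≤ c → 0ℚ < l → 0ℚ < r → l + r ≡ 1ℚ →
                  l * a + r * b ≡ c → a ≡ c
convex-at-bound {a} {b} {c} {l} {r} a≤c b≤c 0<l 0<r l+r≡1 eq =
  ℚP.≤-antisym a≤c (ℚP.≮⇒≥ (λ a<c → ℚP.<-irrefl eq (below a<c)))
  where
  open ℚP.≤-Reasoning
  below : a < c → l * a + r * b < c
  below a<c = begin-strict
    l * a + r * b  <⟨ ℚP.+-mono-<-≤ (ℚP.*-monoʳ-<-pos l {{ℚ.positive 0<l}} a<c)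
                                    (ℚP.*-monoˡ-≤-nonNeg r {{ℚ.nonNegative (ℚP.<⇒≤ 0<r)}} b≤c) ⟩
    l * c + r * c  ≡⟨ sym (ℚP.*-distribʳ-+ c l r) ⟩
    (l + r) * c    ≡⟨ cong (_* c) l+r≡1 ⟩
    1ℚ * c         ≡⟨ ℚP.*-identityˡ c ⟩
    c              ∎

p*q≡0⇒p≡0 : ∀ {p q} → ¬ q ≡ 0ℚ → p * q ≡ 0ℚ → p ≡ 0ℚ
p*q≡0⇒p≡0 {p} {q} q≢0 pq≡0 = begin
  p                ≡⟨ sym (ℚP.*-identityʳ p) ⟩
  p * 1ℚ           ≡⟨ cong (p *_) (sym (ℚP.*-inverseʳ q)) ⟩
  p * (q * q⁻¹)    ≡⟨ sym (ℚP.*-assoc p q q⁻¹) ⟩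
  (p * q) * q⁻¹    ≡⟨ cong (_* q⁻¹) pq≡0 ⟩
  0ℚ * q⁻¹         ≡⟨ ℚP.*-zeroˡ q⁻¹ ⟩
  0ℚ               ∎
  where
  open ≡-Reasoning
  instance
    q≢0′ : ℚ.NonZero q
    q≢0′ = ℚ.≢-nonZero q≢0
  q⁻¹ = ℚ.1/ q

module _ {n : ℕ} (P : Polyhedron n) where
  open Polyhedron P

  ∈P-cong : ∀ {y z} → y ≗ z → _∈P P y → _∈P P z
  ∈P-cong eq (eqs , ineqs) =
    (λ i → trans (sym (·-cong A eq i)) (eqs i)) , (λ j → subst (_≤ d j) (·-cong B eq j) (ineqs j))

  row-blocks : ∀ {y g a α} j → (B · y) j + a * (B · toℚ g) j ≡ d j → 0ℚ < (B · toℚ g) j →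
               a < α → ¬ _∈P P (move y α g)
  row-blocks {y} {g} {a} {α} j tight outward a<α (_ , ineqs) =
    ℚP.<-irrefl refl (ℚP.<-≤-trans beyond (ineqs j))
    where
    open ℚP.≤-Reasoning
    c = (B · toℚ g) j
    beyond : d j < (B · move y α g) j
    beyond = begin-strict
      d j                 ≡⟨ sym tight ⟩
      (B · y) j + a * c   <⟨ ℚP.+-monoʳ-< ((B · y) j) (ℚP.*-monoˡ-<-pos c {{ℚ.positive outward}} a<α) ⟩
      (B · y) j + α * c   ≡⟨ sym (·-move B y α g j) ⟩
      (B · move y α g) j  ∎

  record MaximalStep (y : Point n) (g : IntVec n) (z : Point n) : Set where
    field
      α        : ℚ
      positive : 0ℚ < α
      lands    : z ≗ move y α g
      feasible : _∈P P z
      maximal  : ∀ α′ → α < α′ → ¬ _∈P P (move y α′ g)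

  record Exit (y : Point n) (g : IntVec n) : Set where
    field
      α        : ℚ
      row      : Fin m₂
      feasible : _∈P P (move y α g)
      outward  : 0ℚ < (B · toℚ g) row
      tight    : (B · y) row + α * (B · toℚ g) row ≡ d row

    maximal : ∀ α′ → α < α′ → ¬ _∈P P (move y α′ g)
    maximal _ = row-blocks {y} {g} {α} row tight outward

  maximalStep-length : ∀ {y g z} (x : Exit y g) (s : MaximalStep y g z) → MaximalStep.α s ≡ Exit.α x
  maximalStep-length x s with ℚP.<-cmp (MaximalStep.α s) (Exit.α x)
  ... | tri< s<x _ _ = ⊥-elim (MaximalStep.maximal s _ s<x (Exit.feasible x))
  ... | tri≈ _ s≡x _ = s≡x
  ... | tri> _ _ x<s = ⊥-elim (Exit.maximal x _ x<s (∈P-cong (MaximalStep.lands s) (MaximalStep.feasible s)))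

  maximalStep-lands : ∀ {y g z} (x : Exit y g) → MaximalStep y g z → z ≗ move y (Exit.α x) g
  maximalStep-lands {y} {g} x s t =
    trans (MaximalStep.lands s t) (cong (λ β → y t + β * ι (g t)) (maximalStep-length x s))

  MaximalStep-cong : ∀ {y y′ g g′ z} → y ≗ y′ → g ≗ g′ → MaximalStep y g z → MaximalStep y′ g′ z
  MaximalStep-cong {y} {y′} {g} {g′} y≗y′ g≗g′ s = record
    { α        = α
    ; positive = positive
    ; lands    = λ t → trans (lands t) (moved α t)
    ; feasible = feasible
    ; maximal  = λ α′ α<α′ → maximal α′ α<α′ ∘ ∈P-cong (λ t → sym (moved α′ t))
    }
    where
    open MaximalStep s
    moved : ∀ β → move y β g ≗ move y′ β g′
    moved β t = cong₂ (λ u v → u + β * ι v) (y≗y′ t) (g≗g′ t)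

  IsCircuit-neg : ∀ {g} → IsCircuit P g → IsCircuit P (λ t → ℤ.- g t)
  IsCircuit-neg {g} (inKer , nonZero , coprime , minimal) = inKer′ , nonZero′ , coprime′ , minimal′
    where
    flip-≢0 : ∀ j → ¬ (B · toℚ (λ t → ℤ.- g t)) j ≡ 0ℚ → ¬ (B · toℚ g) j ≡ 0ℚ
    flip-≢0 j ≢0 ≡0 = ≢0 (trans (·-toℚ-neg B g j) (cong -_ ≡0))
    inKer′ : InKer P (toℚ (λ t → ℤ.- g t))
    inKer′ i = trans (·-toℚ-neg A g i) (cong -_ (inKer i))
    nonZero′ : NonZeroVec P (toℚ (λ t → ℤ.- g t))
    nonZero′ ≡0 = nonZero (λ t → ℚP.neg-injective (trans (sym (ι-neg (g t))) (≡0 t)))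
    coprime′ : Coprime P (λ t → ℤ.- g t)
    coprime′ k k∣ = coprime k (λ t → subst (k ∣_) (ℤP.∣-i∣≡∣i∣ (g t)) (k∣ t))
    minimal′ : ∀ z → InKer P z → NonZeroVec P z → SuppSub P z (toℚ (λ t → ℤ.- g t)) →
               SuppSub P (toℚ (λ t → ℤ.- g t)) z
    minimal′ z inKer-z nonZero-z sub j =
      minimal z inKer-z nonZero-z (λ j → flip-≢0 j ∘ sub j) j ∘ flip-≢0 j

  tight-at-combination : ∀ {v x y l} j → _∈P P x → _∈P P y → 0ℚ < l → l < 1ℚ →
                         (∀ t → v t ≡ l * x t + (1ℚ + - l) * y t) → (B · v) j ≡ d j →
                         (B · x) j ≡ d j × (B · y) j ≡ d j
  tight-at-combination {v} {x} {y} {l} j (_ , x≤) (_ , y≤) 0<l l<1 v≡ tight =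
    convex-at-bound (x≤ j) (y≤ j) 0<l 0<r l+r≡1 combination ,
    convex-at-bound (y≤ j) (x≤ j) 0<r 0<l (trans (ℚP.+-comm r l) l+r≡1)
                    (trans (ℚP.+-comm (r * (B · y) j) (l * (B · x) j)) combination)
    where
    r = 1ℚ + - l
    0<r : 0ℚ < r
    0<r = subst (_< r) (ℚP.+-inverseʳ l) (ℚP.+-monoˡ-< (- l) l<1)
    l+r≡1 : l + r ≡ 1ℚ
    l+r≡1 = solve 1 (λ l → l :+ (con 1ℚ :+ :- l) := con 1ℚ) refl l
      where open +-*-Solver
    combination : l * (B · x) j + r * (B · y) j ≡ d j
    combination = trans (sym (·-combination B l x r y j)) (trans (sym (·-cong B v≡ j)) tight)

  module _ {v w : Point n} {k : ℕ} (W : CircuitWalk P v w (suc k)) where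
    open CircuitWalk W

    tail : CircuitWalk P (y (suc zero)) w k
    tail = record
      { y = y ∘ suc ; g = g ∘ suc ; α = α ∘ suc
      ; start = λ _ → refl ; end = end ; step = step ∘ suc ; pos = pos ∘ suc ; circ = circ ∘ suc }

    tail-feasibleMaximal : FeasibleMaximal P W → FeasibleMaximal P tail
    tail-feasibleMaximal (feasible , maximal) = feasible ∘ suc , maximal ∘ suc

    first-step : FeasibleMaximal P W → MaximalStep (y zero) (g zero) (y (suc zero))
    first-step (feasible , maximal) = record
      { α = α zero ; positive = pos zero ; lands = step zero
      ; feasible = feasible (suc zero) ; maximal = maximal zero }

⟨_,_⟩ : {A : Set} → A → A → Fin 2 → A
⟨ a , b ⟩ zero       = a
⟨ a , b ⟩ (suc zero) = b

perp : IntVec 2 → IntVec 2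
perp r = ⟨ ℤ.- r (suc zero) , r zero ⟩

Primitive : IntVec 2 → Set
Primitive r = C.Coprime ℤ.∣ r zero ∣ ℤ.∣ r (suc zero) ∣

coprime-cross : ∀ {a b x y} → C.Coprime a b → C.Coprime x y → a ℕ.* x ≡ b ℕ.* y → x ≡ b × y ≡ a
coprime-cross {a} {b} {x} {y} a⊥b x⊥y ax≡by = ∣-antisym x∣b b∣x , ∣-antisym y∣a a∣y
  where
  x∣b : x ∣ b
  x∣b = C.coprime-divisor x⊥y (subst (x ∣_) (trans ax≡by (ℕP.*-comm b y)) (n∣m*n a))
  b∣x : b ∣ x
  b∣x = C.coprime-divisor (C.sym a⊥b) (subst (b ∣_) (sym ax≡by) (m∣m*n y))
  y∣a : y ∣ a
  y∣a = C.coprime-divisor (C.sym x⊥y) (subst (y ∣_) (trans (sym ax≡by) (ℕP.*-comm a x)) (n∣m*n b))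
  a∣y : a ∣ y
  a∣y = C.coprime-divisor a⊥b (subst (a ∣_) ax≡by (m∣m*n x))

∣i∣≡∣j∣⇒i≡j⊎i≡-j : ∀ {i j} → ℤ.∣ i ∣ ≡ ℤ.∣ j ∣ → i ≡ j ⊎ i ≡ ℤ.- j
∣i∣≡∣j∣⇒i≡j⊎i≡-j {i} {j} eq = signs (ℤP.+∣i∣≡i⊎+∣i∣≡-i i) (ℤP.+∣i∣≡i⊎+∣i∣≡-i j)
  where
  via : ∀ {p q} → + ℤ.∣ i ∣ ≡ p → + ℤ.∣ j ∣ ≡ q → p ≡ q
  via i≡p j≡q = trans (sym i≡p) (trans (cong +_ eq) j≡q)
  signs : + ℤ.∣ i ∣ ≡ i ⊎ + ℤ.∣ i ∣ ≡ ℤ.- i → + ℤ.∣ j ∣ ≡ j ⊎ + ℤ.∣ j ∣ ≡ ℤ.- j → i ≡ j ⊎ i ≡ ℤ.- j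
  signs (inj₁ i≡) (inj₁ j≡) = inj₁ (via i≡ j≡)
  signs (inj₁ i≡) (inj₂ j≡) = inj₂ (via i≡ j≡)
  signs (inj₂ i≡) (inj₁ j≡) = inj₂ (trans (sym (ℤP.neg-involutive i)) (cong ℤ.-_ (via i≡ j≡)))
  signs (inj₂ i≡) (inj₂ j≡) = inj₁ (ℤP.neg-injective (via i≡ j≡))

ab+ba≡0⇒a≡0⊎b≡0 : ∀ a b → a ℤ.* b ℤ.+ b ℤ.* a ≡ + 0 → a ≡ + 0 ⊎ b ≡ + 0
ab+ba≡0⇒a≡0⊎b≡0 a b eq =
  [ (λ ()) , ℤP.i*j≡0⇒i≡0∨j≡0 a ]′ (ℤP.i*j≡0⇒i≡0∨j≡0 (+ 2) (trans (double a b) eq))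
  where
  open ℤSolver.+-*-Solver
  double : ∀ a b → + 2 ℤ.* (a ℤ.* b) ≡ a ℤ.* b ℤ.+ b ℤ.* a
  double = solve 2 (λ a b → con (+ 2) :* (a :* b) := a :* b :+ b :* a) refl

orthogonal-signs : ∀ {a b x y} → a ℤ.* x ℤ.+ b ℤ.* y ≡ + 0 → x ≡ b ⊎ x ≡ ℤ.- b → y ≡ a ⊎ y ≡ ℤ.- a →
                   (x ≡ ℤ.- b × y ≡ a) ⊎ (x ≡ b × y ≡ ℤ.- a)
orthogonal-signs _ (inj₂ x≡-b) (inj₁ y≡a)  = inj₁ (x≡-b , y≡a)
orthogonal-signs _ (inj₁ x≡b)  (inj₂ y≡-a) = inj₂ (x≡b , y≡-a)
orthogonal-signs {a} {b} eq (inj₁ refl) (inj₁ refl) with ab+ba≡0⇒a≡0⊎b≡0 a b eq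
... | inj₁ refl = inj₂ (refl , refl)
... | inj₂ refl = inj₁ (refl , refl)
orthogonal-signs {a} {b} eq (inj₂ refl) (inj₂ refl)
  with ab+ba≡0⇒a≡0⊎b≡0 a b (ℤP.neg-injective (trans (sym (negated a b)) eq))
  where
  open ℤSolver.+-*-Solver
  negated : ∀ a b → a ℤ.* ℤ.- b ℤ.+ b ℤ.* ℤ.- a ≡ ℤ.- (a ℤ.* b ℤ.+ b ℤ.* a)
  negated = solve 2 (λ a b → a :* (:- b) :+ b :* (:- a) := :- (a :* b :+ b :* a)) refl
... | inj₁ refl = inj₁ (refl , refl)
... | inj₂ refl = inj₂ (refl , refl)

primitive-orthogonal : ∀ {u g} → Primitive u → Primitive g →
                       u zero ℤ.* g zero ℤ.+ u (suc zero) ℤ.* g (suc zero) ≡ + 0 →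
                       (g zero ≡ ℤ.- u (suc zero) × g (suc zero) ≡ u zero) ⊎
                       (g zero ≡ u (suc zero) × g (suc zero) ≡ ℤ.- u zero)
primitive-orthogonal {u} {g} u-prim g-prim eq =
  orthogonal-signs eq (∣i∣≡∣j∣⇒i≡j⊎i≡-j ∣x∣≡∣b∣) (∣i∣≡∣j∣⇒i≡j⊎i≡-j ∣y∣≡∣a∣)
  where
  a = u zero
  b = u (suc zero)
  x = g zero
  y = g (suc zero)
  ∣ax∣≡∣by∣ : ℤ.∣ a ∣ ℕ.* ℤ.∣ x ∣ ≡ ℤ.∣ b ∣ ℕ.* ℤ.∣ y ∣
  ∣ax∣≡∣by∣ = begin
    ℤ.∣ a ∣ ℕ.* ℤ.∣ x ∣   ≡⟨ sym (ℤP.abs-* a x) ⟩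
    ℤ.∣ a ℤ.* x ∣          ≡⟨ cong ℤ.∣_∣ ax≡-by ⟩
    ℤ.∣ ℤ.- (b ℤ.* y) ∣    ≡⟨ ℤP.∣-i∣≡∣i∣ (b ℤ.* y) ⟩
    ℤ.∣ b ℤ.* y ∣          ≡⟨ ℤP.abs-* b y ⟩
    ℤ.∣ b ∣ ℕ.* ℤ.∣ y ∣   ∎
    where
    open ≡-Reasoning
    ax≡-by = GroupProperties.inverseˡ-unique (AbelianGroup.group ℤP.+-0-abelianGroup)
                                             (a ℤ.* x) (b ℤ.* y) eq
  ∣x∣≡∣b∣ = proj₁ (coprime-cross u-prim g-prim ∣ax∣≡∣by∣)
  ∣y∣≡∣a∣ = proj₂ (coprime-cross u-prim g-prim ∣ax∣≡∣by∣)

cramer₂ : ∀ {u₀ u₁ w₀ w₁ z₀ z₁} → u₀ * z₀ + (u₁ * z₁ + 0ℚ) ≡ 0ℚ → w₀ * z₀ + (w₁ * z₁ + 0ℚ) ≡ 0ℚ →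
          ¬ u₀ * - w₁ + (u₁ * w₀ + 0ℚ) ≡ 0ℚ → z₀ ≡ 0ℚ × z₁ ≡ 0ℚ
cramer₂ {u₀} {u₁} {w₀} {w₁} {z₀} {z₁} u·z≡0 w·z≡0 D≢0 =
  p*q≡0⇒p≡0 D≢0 (trans (solve₀ u₀ u₁ w₀ w₁ z₀ z₁) (vanish u₁ w₁ w·z≡0 u·z≡0)) ,
  p*q≡0⇒p≡0 D≢0 (trans (solve₁ u₀ u₁ w₀ w₁ z₀ z₁) (vanish w₀ u₀ u·z≡0 w·z≡0))
  where
  open +-*-Solver
  vanish : ∀ a b {p q} → p ≡ 0ℚ → q ≡ 0ℚ → a * p - b * q ≡ 0ℚ
  vanish a b refl refl = solve 2 (λ a b → a :* con 0ℚ :- b :* con 0ℚ := con 0ℚ) refl a b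
  solve₀ : ∀ u₀ u₁ w₀ w₁ z₀ z₁ → z₀ * (u₀ * - w₁ + (u₁ * w₀ + 0ℚ)) ≡
           u₁ * (w₀ * z₀ + (w₁ * z₁ + 0ℚ)) - w₁ * (u₀ * z₀ + (u₁ * z₁ + 0ℚ))
  solve₀ = solve 6 (λ u₀ u₁ w₀ w₁ z₀ z₁ → z₀ :* (u₀ :* (:- w₁) :+ (u₁ :* w₀ :+ con 0ℚ)) :=
           u₁ :* (w₀ :* z₀ :+ (w₁ :* z₁ :+ con 0ℚ)) :- w₁ :* (u₀ :* z₀ :+ (u₁ :* z₁ :+ con 0ℚ))) refl
  solve₁ : ∀ u₀ u₁ w₀ w₁ z₀ z₁ → z₁ * (u₀ * - w₁ + (u₁ * w₀ + 0ℚ)) ≡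
           w₀ * (u₀ * z₀ + (u₁ * z₁ + 0ℚ)) - u₀ * (w₀ * z₀ + (w₁ * z₁ + 0ℚ))
  solve₁ = solve 6 (λ u₀ u₁ w₀ w₁ z₀ z₁ → z₁ :* (u₀ :* (:- w₁) :+ (u₁ :* w₀ :+ con 0ℚ)) :=
           w₀ :* (u₀ :* z₀ :+ (u₁ :* z₁ :+ con 0ℚ)) :- u₀ :* (w₀ :* z₀ :+ (w₁ :* z₁ :+ con 0ℚ))) refl

module _ {m : ℕ} (M : Fin m → Fin 2 → ℤ) where

  ·₂-toℚ : ∀ g i → (M · toℚ g) i ≡ ι (M i zero ℤ.* g zero ℤ.+ M i (suc zero) ℤ.* g (suc zero))
  ·₂-toℚ g i = begin
    ι a * ι x + (ι b * ι y + 0ℚ)  ≡⟨ cong (_+_ (ι a * ι x)) (ℚP.+-identityʳ (ι b * ι y)) ⟩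
    ι a * ι x + ι b * ι y         ≡⟨ sym (cong₂ _+_ (ι-* a x) (ι-* b y)) ⟩
    ι (a ℤ.* x) + ι (b ℤ.* y)     ≡⟨ sym (ι-+ (a ℤ.* x) (b ℤ.* y)) ⟩
    ι (a ℤ.* x ℤ.+ b ℤ.* y)       ∎
    where
    open ≡-Reasoning
    a = M i zero
    b = M i (suc zero)
    x = g zero
    y = g (suc zero)

  ·-perp-self : ∀ i → (M · toℚ (perp (M i))) i ≡ 0ℚ
  ·-perp-self i = trans (·₂-toℚ (perp (M i)) i) (cong ι (cancel (M i zero) (M i (suc zero))))
    where
    open ℤSolver.+-*-Solver
    cancel : ∀ a b → a ℤ.* ℤ.- b ℤ.+ b ℤ.* a ≡ + 0
    cancel = solve 2 (λ a b → a :* (:- b) :+ b :* a := con (+ 0)) refl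

  -- (M · perp (M j)) i is, up to sign, the determinant of rows i and j.
  independent-rows⇒zero : ∀ {z} i j → (M · z) i ≡ 0ℚ → (M · z) j ≡ 0ℚ →
                          ¬ (M · toℚ (perp (M j))) i ≡ 0ℚ → ∀ t → z t ≡ 0ℚ
  independent-rows⇒zero {z} i j zi zj D≢0 = λ { zero → proj₁ z≡0 ; (suc zero) → proj₂ z≡0 }
    where
    D≡ : (M · toℚ (perp (M j))) i ≡
         ι (M i zero) * - ι (M j (suc zero)) + (ι (M i (suc zero)) * ι (M j zero) + 0ℚ)
    D≡ = cong (λ c → ι (M i zero) * c + (ι (M i (suc zero)) * ι (M j zero) + 0ℚ)) (ι-neg (M j (suc zero)))
    z≡0 = cramer₂ {ι (M i zero)} {ι (M i (suc zero))} {ι (M j zero)} {ι (M j (suc zero))} {z zero} {z (suc zero)}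
                  zi zj (D≢0 ∘ trans D≡)

  independent-rows-separate : ∀ {x y} i j → (M · x) i ≡ (M · y) i → (M · x) j ≡ (M · y) j →
                              ¬ (M · toℚ (perp (M j))) i ≡ 0ℚ → x ≗ y
  independent-rows-separate {x} {y} i j xi≡yi xj≡yj D≢0 t =
    x∙y⁻¹≈ε⇒x≈y (x t) (y t)
      (independent-rows⇒zero {λ t → x t - y t} i j (difference xi≡yi) (difference xj≡yj) D≢0 t)
    where
    difference : ∀ {r} → (M · x) r ≡ (M · y) r → (M · (λ t → x t - y t)) r ≡ 0ℚ
    difference {r} eq = trans (·-+ M x (λ t → - y t) r)
                              (trans (cong₂ _+_ eq (·-neg M y r)) (ℚP.+-inverseʳ ((M · y) r)))

polygon : ∀ {m} → (Fin m → Fin 2 → ℤ) → (Fin m → ℚ) → Polyhedron 2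
polygon {m} B d = record { m₁ = 0 ; m₂ = m ; A = λ () ; b = λ () ; B = B ; d = d }

module Polygon {m : ℕ} (B : Fin m → Fin 2 → ℤ) (d : Fin m → ℚ) where

  P : Polyhedron 2
  P = polygon B d

  Edge : Set
  Edge = Fin m × Sign

  edge : Edge → IntVec 2
  edge (j , Sign.+) = perp (B j)
  edge (j , Sign.-) t = ℤ.- perp (B j) t

  perp-isCircuit : ∀ j → Primitive (B j) → IsCircuit P (perp (B j))
  perp-isCircuit j prim = (λ ()) , nonZero , coprime , minimal
    where
    nonZero : NonZeroVec P (toℚ (perp (B j)))
    nonZero ≡0 = 0≢1 (C.0-coprimeTo-m⇒m≡1 (subst₂ (λ a b → C.Coprime ℤ.∣ a ∣ ℤ.∣ b ∣) a≡0 b≡0 prim))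
      where
      0≢1 : ¬ 0 ≡ 1
      0≢1 ()
      a≡0 : B j zero ≡ + 0
      a≡0 = ι-injective (≡0 (suc zero))
      b≡0 : B j (suc zero) ≡ + 0
      b≡0 = ℤP.neg-injective (ι-injective (≡0 zero))
    coprime : Coprime P (perp (B j))
    coprime k k∣ = prim (k∣ (suc zero) , subst (k ∣_) (ℤP.∣-i∣≡∣i∣ (B j (suc zero))) (k∣ zero))
    minimal : ∀ z → InKer P z → NonZeroVec P z → SuppSub P z (toℚ (perp (B j))) →
              SuppSub P (toℚ (perp (B j))) z
    minimal z _ nonZero-z sub i perp≢0 Bz≡0 =
      nonZero-z (independent-rows⇒zero B i j Bz≡0 Bzj≡0 perp≢0)
      where
      Bzj≡0 : (B · z) j ≡ 0ℚ
      Bzj≡0 = decidable-stable ((B · z) j ℚP.≟ 0ℚ) (λ ≢0 → sub j ≢0 (·-perp-self B j))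

  edge-isCircuit : ∀ e → Primitive (B (proj₁ e)) → IsCircuit P (edge e)
  edge-isCircuit (j , Sign.+) prim = perp-isCircuit j prim
  edge-isCircuit (j , Sign.-) prim = IsCircuit-neg P {perp (B j)} (perp-isCircuit j prim)

  bound-from-rows : ∀ {z x R} → _∈P P z → ∀ c μ i j → 0ℚ < c → 0ℚ ≤ μ →
                    c * x ≡ (B · z) i + μ * (B · z) j → d i + μ * d j ≤ c * R → x ≤ R
  bound-from-rows {z} {x} {R} (_ , ineqs) c μ i j 0<c 0≤μ combination certificate =
    ℚP.*-cancelˡ-≤-pos c {{ℚ.positive 0<c}} (begin
      c * x                        ≡⟨ combination ⟩
      (B · z) i + μ * (B · z) j    ≤⟨ ℚP.+-mono-≤ (ineqs i)
                                                  (ℚP.*-monoˡ-≤-nonNeg μ {{ℚ.nonNegative 0≤μ}} (ineqs j)) ⟩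
      d i + μ * d j                ≤⟨ certificate ⟩
      c * R                        ∎)
    where open ℚP.≤-Reasoning

  two-tight-rows⇒vertex : ∀ {v} i j → _∈P P v → (B · v) i ≡ d i → (B · v) j ≡ d j →
                          ¬ (B · toℚ (perp (B j))) i ≡ 0ℚ → IsVertex P v
  two-tight-rows⇒vertex {v} i j v∈P tight-i tight-j independent =
    v∈P , λ x y l x∈P y∈P 0<l l<1 v≡ →
      let agree : ∀ r → (B · v) r ≡ d r → (B · x) r ≡ (B · y) r
          agree r tight = let x-tight , y-tight = tight-at-combination P r x∈P y∈P 0<l l<1 v≡ tight
                          in trans x-tight (sym y-tight)
      in independent-rows-separate B i j (agree i tight-i) (agree j tight-j) independent

  pt : ℚ × ℚ → Point 2
  pt (a , b) = ⟨ a , b ⟩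

  pt-injective : ∀ {p q} → pt p ≗ pt q → p ≡ q
  pt-injective {_ , _} {_ , _} eq = cong₂ _,_ (eq zero) (eq (suc zero))

  _+[_]_ : ℚ × ℚ → ℚ → IntVec 2 → ℚ × ℚ
  (a , b) +[ α ] g = a + α * ι (g zero) , b + α * ι (g (suc zero))

  pt-+[] : ∀ p α g → pt (p +[ α ] g) ≗ move (pt p) α g
  pt-+[] (a , b) α g zero       = refl
  pt-+[] (a , b) α g (suc zero) = refl

  ∈P? : ∀ z → Dec (_∈P P z)
  ∈P? z = map′ ((λ ()) ,_) proj₂ (all? λ j → (B · z) j ℚ.≤? d j)

  -- Every row is tried as the blocking one and each candidate is verified, so a failed search
  -- can only make a check fail, never make it unsound.
  exit? : ∀ p g → Maybe (Exit P (pt p) g)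
  exit? p g = Vector.foldr _<∣>_ nothing exitThrough?
    where
    exitThrough? : Fin m → Maybe (Exit P (pt p) g)
    exitThrough? j with 0ℚ ℚ.<? (B · toℚ g) j
    ... | no _ = nothing
    ... | yes outward = Maybe.map certificate (dec⇒maybe (∈P? (move (pt p) α g) ×-dec
                                                        ((B · pt p) j + α * c ℚP.≟ d j)))
      where
      c = (B · toℚ g) j
      α : ℚ
      α = ((d j - (B · pt p) j) ℚ.÷ c) {{ℚP.pos⇒nonZero c {{ℚ.positive outward}}}}
      certificate : _ → Exit P (pt p) g
      certificate (feasible , tight) = record
        { α = α ; row = j ; feasible = feasible ; outward = outward ; tight = tight }

  all-signs? : {Q : Sign → Set} → (∀ s → Dec (Q s)) → Dec (∀ s → Q s)
  all-signs? Q? = map′ (λ { (q₋ , q₊) Sign.- → q₋ ; (q₋ , q₊) Sign.+ → q₊ })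
                       (λ q → q Sign.- , q Sign.+)
                       (Q? Sign.- ×-dec Q? Sign.+)

  mutual
    AllWalks : (k : ℕ) → ℚ × ℚ → (Vec Edge k → ℚ × ℚ → Set) → Set
    AllWalks zero    p K = K [] p
    AllWalks (suc k) p K = ∀ j s → AfterExit p (j , s) K (exit? p (edge (j , s)))

    AfterExit : ∀ {k} p e → (Vec Edge (suc k) → ℚ × ℚ → Set) → Maybe (Exit P (pt p) (edge e)) → Set
    AfterExit p e K nothing  = ⊥
    -- An exit of length 0 admits no positive step, so the hypothesis 0 < α discards that edge.
    AfterExit {k} p e K (just x) =
      0ℚ < Exit.α x → AllWalks k (p +[ Exit.α x ] edge e) (λ es → K (e ∷ es))

  mutual
    allWalks? : ∀ k p K → (∀ es q → Dec (K es q)) → Dec (AllWalks k p K)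
    allWalks? zero    p K K? = K? [] p
    allWalks? (suc k) p K K? =
      all? λ j → all-signs? λ s → afterExit? p (j , s) K K? (exit? p (edge (j , s)))

    afterExit? : ∀ {k} p e K → (∀ es q → Dec (K es q)) → ∀ x → Dec (AfterExit {k} p e K x)
    afterExit? p e K K? nothing  = no λ ()
    afterExit? p e K K? (just x) = (0ℚ ℚ.<? Exit.α x) →-dec allWalks? _ _ _ (λ es → K? (e ∷ es))

  OppositePair : ∀ {k} → Vec Edge k → Set
  OppositePair {k} es =
    Σ (Fin k) λ i → Σ (Fin k) λ j → ∀ t → edge (lookup es j) t ≡ ℤ.- edge (lookup es i) t

  oppositePair? : ∀ {k} (es : Vec Edge k) → Dec (OppositePair es)
  oppositePair? es =
    any? λ i → any? λ j → all? λ t → edge (lookup es j) t ℤP.≟ ℤ.- edge (lookup es i) t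

  edges-∷ : ∀ {k e es} {g : Fin (suc k) → IntVec 2} → g zero ≗ edge e →
            (∀ i → g (suc i) ≗ edge (lookup es i)) → ∀ i → g i ≗ edge (lookup (e ∷ es) i)
  edges-∷ g₀≗e g≗ zero    = g₀≗e
  edges-∷ g₀≗e g≗ (suc i) = g≗ i

  Coprime⇒Primitive : ∀ {g} → Coprime P g → Primitive g
  Coprime⇒Primitive coprime (k∣g₀ , k∣g₁) = coprime _ λ { zero → k∣g₀ ; (suc zero) → k∣g₁ }

  module Enumeration (rows-primitive : ∀ j → Primitive (B j)) (j₀ : Fin m) where

    -- If B g had full support, perp (B j₀) would have strictly smaller support.
    circuit-annihilates-row : ∀ {g} → IsCircuit P g → Σ (Fin m) λ j → (B · toℚ g) j ≡ 0ℚ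
    circuit-annihilates-row {g} (_ , _ , _ , minimal) =
      decidable-stable (any? λ j → (B · toℚ g) j ℚP.≟ 0ℚ) λ none →
        minimal (toℚ (perp (B j₀))) (λ ()) (proj₁ (proj₂ (perp-isCircuit j₀ (rows-primitive j₀))))
                (λ j _ Bg≡0 → none (j , Bg≡0)) j₀ (λ Bg≡0 → none (j₀ , Bg≡0)) (·-perp-self B j₀)

    circuit⇒edge : ∀ {g} → IsCircuit P g → Σ Edge λ e → g ≗ edge e
    circuit⇒edge {g} circuit@(_ , _ , coprime , _) with circuit-annihilates-row {g} circuit
    ... | j , Bg≡0 with primitive-orthogonal {B j} {g} (rows-primitive j) (Coprime⇒Primitive {g} coprime)
                                             (ι-injective (trans (sym (·₂-toℚ B g j)) Bg≡0))
    ...   | inj₁ (g₀≡ , g₁≡) = (j , Sign.+) , λ { zero → g₀≡ ; (suc zero) → g₁≡ }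
    ...   | inj₂ (g₀≡ , g₁≡) = (j , Sign.-) , λ { zero → trans g₀≡ (sym (ℤP.neg-involutive (B j (suc zero)))) ; (suc zero) → g₁≡ }

    AfterExit-sound : ∀ {p y₁ e k K} → MaximalStep P (pt p) (edge e) y₁ →
                      AfterExit {k} p e K (exit? p (edge e)) →
                      Σ ℚ λ α → y₁ ≗ pt (p +[ α ] edge e) × AllWalks k (p +[ α ] edge e) (λ es → K (e ∷ es))
    AfterExit-sound {p} {y₁} {e} s next with exit? p (edge e)
    ... | nothing = ⊥-elim next
    ... | just x  = Exit.α x ,
                    (λ t → trans (maximalStep-lands P x s t) (sym (pt-+[] p (Exit.α x) (edge e) t))) ,
                    next (subst (0ℚ <_) (maximalStep-length P x s) (MaximalStep.positive s))

    AllWalks-sound : ∀ {k v w p K} (W : CircuitWalk P v w k) → FeasibleMaximal P W → v ≗ pt p →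
                     AllWalks k p K → Σ (Vec Edge k) λ es → Σ (ℚ × ℚ) λ q →
                     (∀ i → CircuitWalk.g W i ≗ edge (lookup es i)) × w ≗ pt q × K es q
    AllWalks-sound {zero} {p = p} W _ v≗p K[]p =
      [] , p , (λ ()) , (λ t → trans (sym (end t)) (trans (start t) (v≗p t))) , K[]p
      where open CircuitWalk W
    AllWalks-sound {suc k} {p = p} {K = K} W fm v≗p all =
      let e , g₀≗e = circuit⇒edge (CircuitWalk.circ W zero)
          step = MaximalStep-cong P (λ t → trans (CircuitWalk.start W t) (v≗p t)) g₀≗e (first-step P W fm)
          _ , y₁≗ , rest = AfterExit-sound {p} {CircuitWalk.y W (suc zero)} {e} {k} {K}
                                           step (all (proj₁ e) (proj₂ e))
          es , q , g≗ , w≗q , Kq = AllWalks-sound (tail P W) (tail-feasibleMaximal P W fm) y₁≗ rest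
      in e ∷ es , q , edges-∷ {g = CircuitWalk.g W} g₀≗e g≗ , w≗q , Kq

    unreachable : ∀ {k p q} → AllWalks k p (λ _ q′ → ¬ q′ ≡ q) →
                  (W : CircuitWalk P (pt p) (pt q) k) → ¬ FeasibleMaximal P W
    unreachable all W fm with AllWalks-sound W fm (λ _ → refl) all
    ... | _ , _ , _ , q≗q′ , q′≢q = q′≢q (sym (pt-injective q≗q′))

    backwards : ∀ {k p q} → AllWalks k p (λ es q′ → q′ ≡ q → OppositePair es) →
                (W : CircuitWalk P (pt p) (pt q) k) → FeasibleMaximal P W → Backwards P W
    backwards all W fm with AllWalks-sound W fm (λ _ → refl) all
    ... | _ , _ , g≗ , q≗q′ , opposite with opposite (sym (pt-injective q≗q′))
    ...   | i , j , gⱼ≡-gᵢ = i , j , λ t → trans (g≗ j t) (trans (gⱼ≡-gᵢ t) (cong ℤ.-_ (sym (g≗ i t))))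

rows : Fin 8 → Fin 2 → ℤ
rows = lookup (⟨ ℤ.- + 3 , ℤ.- + 14 ⟩ ∷ ⟨ + 2 , ℤ.- + 5 ⟩ ∷ ⟨ + 2 , ℤ.- + 3 ⟩ ∷ ⟨ + 1 , ℤ.- + 1 ⟩ ∷
             ⟨ + 1 , + 0 ⟩ ∷ ⟨ + 2 , + 3 ⟩ ∷ ⟨ + 4 , + 25 ⟩ ∷ ⟨ ℤ.- + 1 , + 0 ⟩ ∷ [])

bounds : Fin 8 → ℚ
bounds = lookup (Vec.map ι (+ 140 ∷ + 7 ∷ + 1 ∷ + 0 ∷ + 0 ∷ + 3 ∷ + 63 ∷ + 28 ∷ []))

open Polygon rows bounds

polygon-rows-primitive : ∀ j → Primitive (rows j)
polygon-rows-primitive = from-yes (all? λ j → C.coprime? ℤ.∣ rows j zero ∣ ℤ.∣ rows j (suc zero) ∣)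

open Enumeration polygon-rows-primitive zero

v₁ v₂ : ℚ × ℚ
v₁ = ι (ℤ.- + 28) , ι (ℤ.- + 4)
v₂ = 0ℚ , 0ℚ

_≟₂_ : (p q : ℚ × ℚ) → Dec (p ≡ q)
_≟₂_ = ≡-dec ℚP._≟_ ℚP._≟_

bounded : IsPolytope P
bounded = R , λ z z∈P t → ∣p∣≤R (upper {z} z∈P t) (lower {z} z∈P t)
  where
  open +-*-Solver
  R = ι (+ 28)
  ∣p∣≤R : ∀ {p} → p ≤ R → - p ≤ R → ℚ.∣ p ∣ ≤ R
  ∣p∣≤R {p} p≤R -p≤R with ℚP.∣p∣≡p∨∣p∣≡-p p
  ... | inj₁ ∣p∣≡p  = subst (_≤ R) (sym ∣p∣≡p) p≤R
  ... | inj₂ ∣p∣≡-p = subst (_≤ R) (sym ∣p∣≡-p) -p≤R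
  by-rows : ∀ {z x} → _∈P P z → ∀ c μ i j → c * x ≡ (rows · z) i + μ * (rows · z) j →
            {_ : True (0ℚ ℚ.<? c)} {_ : True (0ℚ ℚ.≤? μ)} {_ : True (bounds i + μ * bounds j ℚ.≤? c * R)} →
            x ≤ R
  by-rows {z} z∈P c μ i j combination {0<c} {0≤μ} {certificate} =
    bound-from-rows {z} z∈P c μ i j (toWitness 0<c) (toWitness 0≤μ) combination (toWitness certificate)
  row : Fin 8 → Polynomial 2 → Polynomial 2 → Polynomial 2
  row i x y = con (ι (rows i zero)) :* x :+ (con (ι (rows i (suc zero))) :* y :+ con 0ℚ)
  upper : ∀ {z} → _∈P P z → ∀ t → z t ≤ R
  upper {z} z∈P zero = by-rows {z} z∈P 1ℚ 0ℚ (# 4) (# 4)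
    (solve 2 (λ x y → con 1ℚ :* x := row (# 4) x y :+ con 0ℚ :* row (# 4) x y) refl (z zero) (z (suc zero)))
  upper {z} z∈P (suc zero) = by-rows {z} z∈P (ι (+ 25)) (ι (+ 4)) (# 6) (# 7)
    (solve 2 (λ x y → con (ι (+ 25)) :* y := row (# 6) x y :+ con (ι (+ 4)) :* row (# 7) x y) refl
           (z zero) (z (suc zero)))
  lower : ∀ {z} → _∈P P z → ∀ t → - z t ≤ R
  lower {z} z∈P zero = by-rows {z} z∈P 1ℚ 0ℚ (# 7) (# 7)
    (solve 2 (λ x y → con 1ℚ :* (:- x) := row (# 7) x y :+ con 0ℚ :* row (# 7) x y) refl (z zero) (z (suc zero)))
  lower {z} z∈P (suc zero) = by-rows {z} z∈P (ι (+ 14)) (ι (+ 3)) (# 0) (# 4)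
    (solve 2 (λ x y → con (ι (+ 14)) :* (:- y) := row (# 0) x y :+ con (ι (+ 3)) :* row (# 4) x y) refl
           (z zero) (z (suc zero)))

v₁-vertex : IsVertex P (pt v₁)
v₁-vertex = two-tight-rows⇒vertex (# 0) (# 7) (from-yes (∈P? (pt v₁))) refl refl (λ ())

v₂-vertex : IsVertex P (pt v₂)
v₂-vertex = two-tight-rows⇒vertex (# 3) (# 4) (from-yes (∈P? (pt v₂))) refl refl (λ ())

route : Fin 4 → ℚ × ℚ
route = lookup (v₁ ∷ (ι (ℤ.- + 28) , ι (+ 7)) ∷ (0ℚ , ι (+ 1)) ∷ v₂ ∷ [])

directions : Fin 3 → Edge
directions = lookup ((# 4 , Sign.+) ∷ (# 0 , Sign.+) ∷ (# 4 , Sign.-) ∷ [])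

lengths : Fin 3 → ℚ
lengths = lookup (ι (+ 11) ∷ ι (+ 2) ∷ ι (+ 1) ∷ [])

blocking : Fin 3 → Fin 8
blocking = lookup (# 6 ∷ # 4 ∷ # 3 ∷ [])

W₀ : CircuitWalk P (pt v₁) (pt v₂) 3
W₀ = record
  { y     = pt ∘ route
  ; g     = edge ∘ directions
  ; α     = lengths
  ; start = λ _ → refl
  ; end   = λ _ → refl
  ; step  = from-yes (all? λ i → all? λ t →
              pt (route (suc i)) t ℚP.≟ move (pt (route (inject₁ i))) (lengths i) (edge (directions i)) t)
  ; pos   = from-yes (all? λ i → 0ℚ ℚ.<? lengths i)
  ; circ  = λ i → edge-isCircuit (directions i) (polygon-rows-primitive (proj₁ (directions i)))
  }

W₀-feasibleMaximal : FeasibleMaximal P W₀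
W₀-feasibleMaximal =
  from-yes (all? λ i → ∈P? (pt (route i))) ,
  λ i _ → row-blocks P {source i} {edge (directions i)} {lengths i} (blocking i) (tight i) (outward i)
  where
  source : Fin 3 → Point 2
  source i = pt (route (inject₁ i))
  c : Fin 3 → ℚ
  c i = (rows · toℚ (edge (directions i))) (blocking i)
  tight : ∀ i → (rows · source i) (blocking i) + lengths i * c i ≡ bounds (blocking i)
  tight = from-yes (all? λ i → (rows · source i) (blocking i) + lengths i * c i ℚP.≟ bounds (blocking i))
  outward : ∀ i → 0ℚ < c i
  outward = from-yes (all? λ i → 0ℚ ℚ.<? c i)

≢v₂? : ∀ {k} (es : Vec Edge k) q → Dec (¬ q ≡ v₂)
≢v₂? _ q = ¬? (q ≟₂ v₂)

shortest : ∀ k (W : CircuitWalk P (pt v₁) (pt v₂) k) → FeasibleMaximal P W → 3 ℕ.≤ k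
shortest 0 W = ⊥-elim ∘ unreachable (from-yes (allWalks? 0 v₁ (λ _ q → ¬ q ≡ v₂) ≢v₂?)) W
shortest 1 W = ⊥-elim ∘ unreachable (from-yes (allWalks? 1 v₁ (λ _ q → ¬ q ≡ v₂) ≢v₂?)) W
shortest 2 W = ⊥-elim ∘ unreachable (from-yes (allWalks? 2 v₁ (λ _ q → ¬ q ≡ v₂) ≢v₂?)) W
shortest (suc (suc (suc k))) _ _ = ℕ.s≤s (ℕ.s≤s (ℕ.s≤s ℕ.z≤n))

three-step-walks-backwards : (W : CircuitWalk P (pt v₁) (pt v₂) 3) → FeasibleMaximal P W → Backwards P W
three-step-walks-backwards =
  backwards (from-yes (allWalks? 3 v₁ (λ es q → q ≡ v₂ → OppositePair es) λ es q → (q ≟₂ v₂) →-dec oppositePair? es))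

lemma9 : Σ (Polyhedron 2) λ P → IsPolytope P ×
    Σ (Point 2) λ v₁ → Σ (Point 2) λ v₂ → IsVertex P v₁ × IsVertex P v₂ ×
    Σ ℕ λ k → IsCDfm P v₁ v₂ k ×
      (∀ (W : CircuitWalk P v₁ v₂ k) → FeasibleMaximal P W → Backwards P W) ×
      (∀ k′ → IsCDfmb P v₁ v₂ k′ → ¬ (k′ ≡ k))
lemma9 = P , bounded , pt v₁ , pt v₂ , v₁-vertex , v₂-vertex ,
         3 , ((W₀ , W₀-feasibleMaximal) , shortest) , three-step-walks-backwards ,
         λ { _ ((W , feasibleMaximal , non-backwards) , _) refl →
               non-backwards (three-step-walks-backwards W feasibleMaximal) }
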